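{- Let $*=\langle 0\mid 0\rangle$. For every $G\in\mathcal{W}_\mathbb{Z}$, $G+*+*\approx G$. The map $G\mapsto G+*$ induces an involution on $\mathcal{W}_\mathbb{Z}/\approx$ interchanging the classes of even-tempered games $\mathcal{W}^0_\mathbb{Z}/\approx$ and of odd-tempered games $\mathcal{W}^1_\mathbb{Z}/\approx$. As a commutative monoid (under $+$), $\mathcal{W}_\mathbb{Z}/\approx$ is isomorphic to the direct product of the cyclic group $\mathbb{Z}_2$ with the submonoid $\mathcal{W}^0_\mathbb{Z}/\approx$.
   Context: Well-tempered $\mathbb{Z}$-valued games: an even-tempered game is an integer (a "number", with no options) or $\langle L\mid R\rangle$ with $L,R$ finite nonempty sets of odd-tempered games; an odd-tempered game is $\langle L\mid R\rangle$ with $L,R$ finite nonempty sets of even-tempered games; $\mathcal{W}_\mathbb{Z}$ is the set of all of them, $\mathcal{W}^0_\mathbb{Z}$ and $\mathcal{W}^1_\mathbb{Z}$ the even- and odd-tempered ones. Outcomes: $L(n)=R(n)=n$ for numbers; otherwise $L(G)=\max_{G^L}R(G^L)$, $R(G)=\min_{G^R}L(G^R)$. Sum: integer sum if both numbers, otherwise $G+H=\langle G^L+H, G+H^L\mid G^R+H, G+H^R\rangle$ (associative, commutative, identity $0$). $G\approx H$ iff $(L(G+X),R(G+X))=(L(H+X),R(H+X))$ for all $X\in\mathcal{W}_\mathbb{Z}$; this is a congruence for $+$. -}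

module Defs where

open import Data.Integer using (ℤ; +_; _⊔_; _⊓_) renaming (_+_ to _+ℤ_)
open import Data.List using (List; []; _∷_; _++_)
open import Data.List.NonEmpty using (List⁺; _∷_; toList)
open import Data.List.Relation.Unary.All using (All; []; _∷_)
open import Data.List.Relation.Unary.All.Properties using (++⁺)
open import Data.Parity.Base using (Parity; 0ℙ; 1ℙ; _⁻¹) renaming (_+_ to _+ℙ_)
open import Data.Product using (Σ; _×_; _,_; proj₁; proj₂)
open import Relation.Binary.PropositionalEquality using (_≡_; refl; subst)

-- Temper is imposed separately by the predicate WT below.

data Game : Set where
  num   : ℤ → Game
  ⟨_∣_⟩ : List⁺ Game → List⁺ Game → Game

infixl 6 _⊞_

mutual
  _⊞_ : Game → Game → Game
  num m ⊞ num n = num (m +ℤ n)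
  num m ⊞ ⟨ HL ∣ HR ⟩ = ⟨ addʳ⁺ (num m) HL ∣ addʳ⁺ (num m) HR ⟩
  ⟨ GL ∣ GR ⟩ ⊞ num n = ⟨ addˡ⁺ GL (num n) ∣ addˡ⁺ GR (num n) ⟩
  G@(⟨ GL ∣ GR ⟩) ⊞ H@(⟨ HL ∣ HR ⟩) =
    ⟨ app (addˡ⁺ GL H) (addʳ⁺ G HL) ∣ app (addˡ⁺ GR H) (addʳ⁺ G HR) ⟩

  addˡ : List Game → Game → List Game
  addˡ []       H = []
  addˡ (x ∷ xs) H = (x ⊞ H) ∷ addˡ xs H

  addˡ⁺ : List⁺ Game → Game → List⁺ Game
  addˡ⁺ (x ∷ xs) H = (x ⊞ H) ∷ addˡ xs H

  addʳ : Game → List Game → List Game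
  addʳ G []       = []
  addʳ G (y ∷ ys) = (G ⊞ y) ∷ addʳ G ys

  addʳ⁺ : Game → List⁺ Game → List⁺ Game
  addʳ⁺ G (y ∷ ys) = (G ⊞ y) ∷ addʳ G ys

  app : List⁺ Game → List⁺ Game → List⁺ Game
  app (x ∷ xs) ys = x ∷ (xs ++ toList ys)

mutual
  Lo : Game → ℤ
  Lo (num n)     = n
  Lo ⟨ GL ∣ GR ⟩ = maxRo⁺ GL

  Ro : Game → ℤ
  Ro (num n)     = n
  Ro ⟨ GL ∣ GR ⟩ = minLo⁺ GR

  maxRo⁺ : List⁺ Game → ℤ
  maxRo⁺ (x ∷ xs) = maxRo (Ro x) xs

  maxRo : ℤ → List Game → ℤ
  maxRo acc []       = acc
  maxRo acc (x ∷ xs) = maxRo (acc ⊔ Ro x) xs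

  minLo⁺ : List⁺ Game → ℤ
  minLo⁺ (x ∷ xs) = minLo (Lo x) xs

  minLo : ℤ → List Game → ℤ
  minLo acc []       = acc
  minLo acc (x ∷ xs) = minLo (acc ⊓ Lo x) xs

-- Temper.  WT 0ℙ G : G is even-tempered;  WT 1ℙ G : G is odd-tempered.

data WT : Parity → Game → Set where
  num  : ∀ {n} → WT 0ℙ (num n)
  node : ∀ {t L R} → All (WT (t ⁻¹)) (toList L) → All (WT (t ⁻¹)) (toList R)
       → WT t ⟨ L ∣ R ⟩

IsW : Game → Set
IsW G = Σ Parity λ t → WT t G

infix 4 _≈_

_≈_ : Game → Game → Set
G ≈ H = ∀ X → IsW X → (Lo (G ⊞ X) ≡ Lo (H ⊞ X)) × (Ro (G ⊞ X) ≡ Ro (H ⊞ X))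

star : Game
star = ⟨ num (+ 0) ∷ [] ∣ num (+ 0) ∷ [] ⟩

zeroG : Game
zeroG = num (+ 0)

private
  p+0 : ∀ p → p +ℙ 0ℙ ≡ p
  p+0 0ℙ = refl
  p+0 1ℙ = refl

  inv+ : ∀ p q → p ⁻¹ +ℙ q ≡ (p +ℙ q) ⁻¹
  inv+ 0ℙ q = refl
  inv+ 1ℙ 0ℙ = refl
  inv+ 1ℙ 1ℙ = refl

  +inv : ∀ p q → p +ℙ q ⁻¹ ≡ (p +ℙ q) ⁻¹
  +inv 0ℙ q = refl
  +inv 1ℙ 0ℙ = refl
  +inv 1ℙ 1ℙ = refl

mutual
  WT-⊞ : ∀ {p q G H} → WT p G → WT q H → WT (p +ℙ q) (G ⊞ H)
  WT-⊞ num num = num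
  WT-⊞ {q = q} (num {m}) (node {L = y ∷ ys} {R = z ∷ zs} hl hr) =
    node (WT-addʳ num hl) (WT-addʳ num hr)
  WT-⊞ {p = p} (node {L = x ∷ xs} {R = z ∷ zs} gl gr) (num {n}) =
    subst (λ r → WT r _) (sym (p+0 p))
      (node (subst (λ r → All (WT r) _) (p+0 (p ⁻¹)) (WT-addˡ gl num))
            (subst (λ r → All (WT r) _) (p+0 (p ⁻¹)) (WT-addˡ gr num)))
    where open import Relation.Binary.PropositionalEquality using (sym)
  WT-⊞ {p = p} {q = q} g@(node {L = x ∷ xs} {R = u ∷ us} gl gr) h@(node {L = y ∷ ys} {R = v ∷ vs} hl hr) =
    node (++⁺ (cast (inv+ p q) (WT-addˡ gl h)) (cast (+inv p q) (WT-addʳ g hl)))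
         (++⁺ (cast (inv+ p q) (WT-addˡ gr h)) (cast (+inv p q) (WT-addʳ g hr)))
    where
      cast : ∀ {a b} {xs : List Game} → a ≡ b → All (WT a) xs → All (WT b) xs
      cast refl w = w

  WT-addˡ : ∀ {p q xs H} → All (WT p) xs → WT q H → All (WT (p +ℙ q)) (addˡ xs H)
  WT-addˡ []       h = []
  WT-addˡ (w ∷ ws) h = WT-⊞ w h ∷ WT-addˡ ws h

  WT-addʳ : ∀ {p q G ys} → WT p G → All (WT q) ys → All (WT (p +ℙ q)) (addʳ G ys)
  WT-addʳ g []       = []
  WT-addʳ g (w ∷ ws) = WT-⊞ g w ∷ WT-addʳ g ws

-- The carriers W_Z, W^0_Z with their sums (the quotient by ≈ is handled
-- setoid-style: all statements are up to ≈).

W : Set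
W = Σ Game IsW

_+W_ : W → W → W
(G , p , g) +W (H , q , h) = (G ⊞ H , p +ℙ q , WT-⊞ g h)

zeroW : W
zeroW = (zeroG , 0ℙ , num)

W⁰ : Set
W⁰ = Σ Game (WT 0ℙ)

_+W⁰_ : W⁰ → W⁰ → W⁰
(G , g) +W⁰ (H , h) = (G ⊞ H , WT-⊞ g h)

zeroW⁰ : W⁰
zeroW⁰ = (zeroG , num)

_≈W_ : W → W → Set
x ≈W y = proj₁ x ≈ proj₁ y

Z₂×W⁰ : Set
Z₂×W⁰ = Parity × W⁰

_·_ : Z₂×W⁰ → Z₂×W⁰ → Z₂×W⁰
(a , x) · (b , y) = (a +ℙ b , x +W⁰ y)

unit : Z₂×W⁰
unit = (0ℙ , zeroW⁰)

_∼_ : Z₂×W⁰ → Z₂×W⁰ → Set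
(a , x) ∼ (b , y) = (a ≡ b) × (proj₁ x ≈ proj₁ y)

-- Monoid isomorphism (W/≈) ≅ Z₂ × (W⁰/≈), represented on representatives.
MonoidIso : Set
MonoidIso = Σ (W → Z₂×W⁰) λ φ →
    (∀ x y → x ≈W y → φ x ∼ φ y)
  × (∀ x y → φ x ∼ φ y → x ≈W y)
  × (∀ z → Σ W λ x → φ x ∼ z)
  × (∀ x y → φ (x +W y) ∼ (φ x · φ y))
  × (φ zeroW ∼ unit)

module Submission where

-- By induction the
--     outcomes of A + * + * are those of A, so G + * + * ≈ G (all X at once).
-- (4) Temper separation: adding the switch ⟨ -N ∣ N ⟩ for N larger than the
--     spread of the integers occurring in a game moves the Left outcome below
--     (even temper) or above (odd temper) that spread, so no even-tempered game
--     is ≈ to an odd-tempered one.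
-- (5) The isomorphism keeps even games and sends an odd G to (1, G + *);
--     (2)-(4) give well-definedness, injectivity, surjectivity and additivity.

open import Defs
open import Data.Empty using (⊥; ⊥-elim)
open import Data.Integer using (ℤ; +_; -_; _≤_; _<_; _⊔_; _⊓_; -<+; +<+)
  renaming (_+_ to _+ℤ_; _-_ to _-ℤ_)
open import Data.Integer.Properties
  using ( ≤-refl; ≤-trans; ≤-reflexive; ≤-antisym; <⇒≱; i≤i⊔j; i≤j⊔i; i⊓j≤i; i⊓j≤j
        ; ⊔-lub; ⊓-glb; +-monoˡ-≤; +-monoʳ-<; +-identityʳ; +-comm; +-assoc)
import Data.Integer.Properties as ℤP
open import Data.Integer.Tactic.RingSolver using (solve-∀)
open import Data.List using (List; []; _∷_; _++_; map)
open import Data.List.NonEmpty using (_∷_; toList; head)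
open import Data.List.Properties using (map-id; map-++; map-∘; ++-assoc; ++-identityʳ)
open import Data.List.Relation.Unary.All as All using (All; []; _∷_)
open import Data.List.Relation.Unary.All.Properties using (++⁺; ++⁻ˡ; ++⁻ʳ)
  renaming (map⁺ to All-map⁺; map⁻ to All-map⁻)
open import Data.List.Relation.Unary.Any as Any using (Any; here; there)
open import Data.List.Relation.Unary.Any.Properties using (++⁺ˡ; ++⁺ʳ)
  renaming (map⁺ to Any-map⁺)
open import Data.Maybe using (Maybe; just; nothing; zipWith)
open import Data.Maybe.Properties using (just-injective)
open import Data.Nat.Base using (z≤n; s≤s)
open import Data.Parity.Base using (0ℙ; 1ℙ) renaming (_+_ to _+ℙ_)
open import Data.Product using (Σ; _×_; _,_; proj₁; proj₂)
open import Data.Unit using (⊤; tt)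
open import Function using (id; _∘_)
open import Relation.Binary.Bundles using (Setoid)
open import Relation.Binary.PropositionalEquality
  using (_≡_; refl; sym; trans; cong; cong₂; subst; subst₂; module ≡-Reasoning)
open import Relation.Nullary using (¬_)

Match : {A : Set} → (A → A → Set) → List A → List A → Set
Match R xs ys = All (λ x → Any (R x) ys) xs × All (λ y → Any (λ x → R x y) xs) ys

module _ {A : Set} where

  all-any : ∀ {P Q : A → Set} {xs} → All P xs → Any Q xs → Any (λ x → P x × Q x) xs
  all-any (p ∷ _)  (here q)  = here (p , q)
  all-any (_ ∷ ps) (there q) = there (all-any ps q)

  match-map : ∀ {R : A → A → Set} (f g : A → A) {xs} →
              All (λ x → R (f x) (g x)) xs → Match R (map f xs) (map g xs)
  match-map f g []       = [] , []
  match-map f g (p ∷ ps) =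
    let (fw , bw) = match-map f g ps in
    here p ∷ All.map there fw , here p ∷ All.map there bw

  match-refl : ∀ {R : A → A → Set} {xs} → All (λ x → R x x) xs → Match R xs xs
  match-refl {R} {xs} p = subst₂ (Match R) (map-id xs) (map-id xs) (match-map id id p)

  match-image : ∀ {R S : A → A → Set} {f g : A → A} {xs ys} →
                All (λ x → ∀ {y} → R x y → S (f x) (g y)) xs →
                Match R xs ys → Match S (map f xs) (map g ys)
  match-image h (fw , bw) =
      All-map⁺ (All.zipWith (λ (hx , a) → Any-map⁺ (Any.map (λ r → hx r) a)) (h , fw))
    , All-map⁺ (All.map (λ a → Any-map⁺ (Any.map (λ (hx , r) → hx r) (all-any h a))) bw)

  match-mono : ∀ {R S : A → A → Set} {xs ys} →
               All (λ x → ∀ {y} → R x y → S x y) xs → Match R xs ys → Match S xs ys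
  match-mono {S = S} {xs} {ys} h m =
    subst₂ (Match S) (map-id xs) (map-id ys) (match-image {f = id} {g = id} h m)

  match-sym : ∀ {R : A → A → Set} {xs ys} →
              All (λ x → ∀ {y} → R x y → R y x) xs → Match R xs ys → Match R ys xs
  match-sym h (fw , bw) =
      All.map (λ a → Any.map (λ (hx , r) → hx r) (all-any h a)) bw
    , All.zipWith (λ (hx , a) → Any.map (λ r → hx r) a) (h , fw)

  match-trans : ∀ {R : A → A → Set} {xs ys zs} →
                All (λ x → ∀ {y z} → R x y → R y z → R x z) xs →
                Match R xs ys → Match R ys zs → Match R xs zs
  match-trans h (fw₁ , bw₁) (fw₂ , bw₂) =
      All.zipWith (λ (hx , a) → let (_ , b , r) = Any.satisfied (all-any fw₂ a)
                                in Any.map (hx r) b) (h , fw₁)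
    , All.map (λ c → let (_ , d , r) = Any.satisfied (all-any bw₁ c)
                     in Any.map (λ (hx , q) → hx q r) (all-any h d)) bw₂

  match-++ : ∀ {R : A → A → Set} {a b c d} →
             Match R a c → Match R b d → Match R (a ++ b) (c ++ d)
  match-++ {a = a} {c = c} (fw₁ , bw₁) (fw₂ , bw₂) =
      ++⁺ (All.map ++⁺ˡ fw₁) (All.map (++⁺ʳ c) fw₂)
    , ++⁺ (All.map ++⁺ˡ bw₁) (All.map (++⁺ʳ a) bw₂)

  match-swap : ∀ {R : A → A → Set} {a b c d} →
               Match R a d → Match R b c → Match R (a ++ b) (c ++ d)
  match-swap {a = a} {c = c} (fw₁ , bw₁) (fw₂ , bw₂) =
      ++⁺ (All.map (++⁺ʳ c) fw₁) (All.map ++⁺ˡ fw₂)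
    , ++⁺ (All.map (++⁺ʳ a) bw₂) (All.map ++⁺ˡ bw₁)

data Side : Set where
  left right : Side

Opts : Side → Game → List Game
Opts _     (num _)     = []
Opts left  ⟨ GL ∣ _ ⟩  = toList GL
Opts right ⟨ _ ∣ GR ⟩  = toList GR

IsNode : Game → Set
IsNode (num _)     = ⊥
IsNode ⟨ _ ∣ _ ⟩   = ⊤

⊞-node : ∀ G {L R} → IsNode (G ⊞ ⟨ L ∣ R ⟩)
⊞-node (num _)   = tt
⊞-node ⟨ _ ∣ _ ⟩ = tt

addˡ-map : ∀ xs H → addˡ xs H ≡ map (_⊞ H) xs
addˡ-map []       H = refl
addˡ-map (x ∷ xs) H = cong (x ⊞ H ∷_) (addˡ-map xs H)

addʳ-map : ∀ G ys → addʳ G ys ≡ map (G ⊞_) ys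
addʳ-map G []       = refl
addʳ-map G (y ∷ ys) = cong (G ⊞ y ∷_) (addʳ-map G ys)

addˡ⁺-map : ∀ xs H → toList (addˡ⁺ xs H) ≡ map (_⊞ H) (toList xs)
addˡ⁺-map (x ∷ xs) H = cong (x ⊞ H ∷_) (addˡ-map xs H)

addʳ⁺-map : ∀ G ys → toList (addʳ⁺ G ys) ≡ map (G ⊞_) (toList ys)
addʳ⁺-map G (y ∷ ys) = cong (G ⊞ y ∷_) (addʳ-map G ys)

opts-⊞ : ∀ s G H → Opts s (G ⊞ H) ≡ map (_⊞ H) (Opts s G) ++ map (G ⊞_) (Opts s H)
opts-⊞ s     (num m)     (num n)     = refl
opts-⊞ left  (num m)     ⟨ HL ∣ _ ⟩  = addʳ⁺-map (num m) HL
opts-⊞ right (num m)     ⟨ _ ∣ HR ⟩  = addʳ⁺-map (num m) HR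
opts-⊞ left  ⟨ GL ∣ _ ⟩  (num n)     = trans (addˡ⁺-map GL (num n)) (sym (++-identityʳ _))
opts-⊞ right ⟨ _ ∣ GR ⟩  (num n)     = trans (addˡ⁺-map GR (num n)) (sym (++-identityʳ _))
opts-⊞ left  G@(⟨ GL ∣ _ ⟩) H@(⟨ HL ∣ _ ⟩) = cong₂ _++_ (addˡ⁺-map GL H) (addʳ⁺-map G HL)
opts-⊞ right G@(⟨ _ ∣ GR ⟩) H@(⟨ _ ∣ HR ⟩) = cong₂ _++_ (addˡ⁺-map GR H) (addʳ⁺-map G HR)

opts-⊞⊞ˡ : ∀ s G H K → Opts s ((G ⊞ H) ⊞ K) ≡
  map (λ g → (g ⊞ H) ⊞ K) (Opts s G) ++
    (map (λ h → (G ⊞ h) ⊞ K) (Opts s H) ++ map ((G ⊞ H) ⊞_) (Opts s K))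
opts-⊞⊞ˡ s G H K = begin
  Opts s ((G ⊞ H) ⊞ K)
    ≡⟨ opts-⊞ s (G ⊞ H) K ⟩
  map (_⊞ K) (Opts s (G ⊞ H)) ++ OK
    ≡⟨ cong (λ l → map (_⊞ K) l ++ OK) (opts-⊞ s G H) ⟩
  map (_⊞ K) (map (_⊞ H) OG ++ map (G ⊞_) OH) ++ OK
    ≡⟨ cong (_++ OK) (map-++ (_⊞ K) (map (_⊞ H) OG) (map (G ⊞_) OH)) ⟩
  (map (_⊞ K) (map (_⊞ H) OG) ++ map (_⊞ K) (map (G ⊞_) OH)) ++ OK
    ≡⟨ ++-assoc (map (_⊞ K) (map (_⊞ H) OG)) (map (_⊞ K) (map (G ⊞_) OH)) OK ⟩
  map (_⊞ K) (map (_⊞ H) OG) ++ (map (_⊞ K) (map (G ⊞_) OH) ++ OK)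
    ≡⟨ cong₂ (λ u v → u ++ (v ++ OK)) (sym (map-∘ {g = _⊞ K} {f = _⊞ H} OG))
                                      (sym (map-∘ {g = _⊞ K} {f = G ⊞_} OH)) ⟩
  map (λ g → (g ⊞ H) ⊞ K) OG ++ (map (λ h → (G ⊞ h) ⊞ K) OH ++ OK) ∎
  where
  open ≡-Reasoning
  OG = Opts s G
  OH = Opts s H
  OK = map ((G ⊞ H) ⊞_) (Opts s K)

opts-⊞⊞ʳ : ∀ s G H K → Opts s (G ⊞ (H ⊞ K)) ≡
  map (λ g → g ⊞ (H ⊞ K)) (Opts s G) ++
    (map (λ h → G ⊞ (h ⊞ K)) (Opts s H) ++ map (λ k → G ⊞ (H ⊞ k)) (Opts s K))
opts-⊞⊞ʳ s G H K = begin
  Opts s (G ⊞ (H ⊞ K))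
    ≡⟨ opts-⊞ s G (H ⊞ K) ⟩
  OG ++ map (G ⊞_) (Opts s (H ⊞ K))
    ≡⟨ cong (λ l → OG ++ map (G ⊞_) l) (opts-⊞ s H K) ⟩
  OG ++ map (G ⊞_) (map (_⊞ K) OH ++ map (H ⊞_) OK)
    ≡⟨ cong (OG ++_) (map-++ (G ⊞_) (map (_⊞ K) OH) (map (H ⊞_) OK)) ⟩
  OG ++ (map (G ⊞_) (map (_⊞ K) OH) ++ map (G ⊞_) (map (H ⊞_) OK))
    ≡⟨ cong₂ (λ u v → OG ++ (u ++ v)) (sym (map-∘ {g = G ⊞_} {f = _⊞ K} OH))
                                      (sym (map-∘ {g = G ⊞_} {f = H ⊞_} OK)) ⟩
  OG ++ (map (λ h → G ⊞ (h ⊞ K)) OH ++ map (λ k → G ⊞ (H ⊞ k)) OK) ∎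
  where
  open ≡-Reasoning
  OG = map (_⊞ (H ⊞ K)) (Opts s G)
  OH = Opts s H
  OK = Opts s K

module _ (P : Game → Set) (step : ∀ G → (∀ s → All P (Opts s G)) → P G) where
  mutual
    game-ind : ∀ G → P G
    game-ind (num n)               = step (num n) (λ _ → [])
    game-ind G@(⟨ x ∷ xs ∣ y ∷ ys ⟩) =
      step G λ { left → game-ind x ∷ game-indAll xs ; right → game-ind y ∷ game-indAll ys }

    game-indAll : ∀ xs → All P xs
    game-indAll []       = []
    game-indAll (x ∷ xs) = game-ind x ∷ game-indAll xs

maxRo-acc : ∀ a xs → a ≤ maxRo a xs
maxRo-acc a []       = ≤-refl
maxRo-acc a (x ∷ xs) = ≤-trans (i≤i⊔j a (Ro x)) (maxRo-acc _ xs)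

maxRo-≥ : ∀ {c} a xs → Any (λ x → c ≤ Ro x) xs → c ≤ maxRo a xs
maxRo-≥ a (x ∷ xs) (here p)  = ≤-trans p (≤-trans (i≤j⊔i a (Ro x)) (maxRo-acc _ xs))
maxRo-≥ a (x ∷ xs) (there p) = maxRo-≥ _ xs p

maxRo-lub : ∀ {c} a xs → a ≤ c → All (λ x → Ro x ≤ c) xs → maxRo a xs ≤ c
maxRo-lub a []       a≤c []       = a≤c
maxRo-lub a (x ∷ xs) a≤c (p ∷ ps) = maxRo-lub _ xs (⊔-lub a≤c p) ps

minLo-acc : ∀ a xs → minLo a xs ≤ a
minLo-acc a []       = ≤-refl
minLo-acc a (x ∷ xs) = ≤-trans (minLo-acc _ xs) (i⊓j≤i a (Lo x))

minLo-≤ : ∀ {c} a xs → Any (λ x → Lo x ≤ c) xs → minLo a xs ≤ c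
minLo-≤ a (x ∷ xs) (here p)  = ≤-trans (≤-trans (minLo-acc _ xs) (i⊓j≤j a (Lo x))) p
minLo-≤ a (x ∷ xs) (there p) = minLo-≤ _ xs p

minLo-glb : ∀ {c} a xs → c ≤ a → All (λ x → c ≤ Lo x) xs → c ≤ minLo a xs
minLo-glb a []       c≤a []       = c≤a
minLo-glb a (x ∷ xs) c≤a (p ∷ ps) = minLo-glb _ xs (⊓-glb c≤a p) ps

Lo-≥ : ∀ G {c} → Any (λ x → c ≤ Ro x) (Opts left G) → c ≤ Lo G
Lo-≥ (num _) ()
Lo-≥ ⟨ x ∷ xs ∣ _ ⟩ (here p)  = ≤-trans p (maxRo-acc _ xs)
Lo-≥ ⟨ x ∷ xs ∣ _ ⟩ (there p) = maxRo-≥ _ xs p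

Lo-lub : ∀ G {c} → IsNode G → All (λ x → Ro x ≤ c) (Opts left G) → Lo G ≤ c
Lo-lub ⟨ x ∷ xs ∣ _ ⟩ _ (p ∷ ps) = maxRo-lub _ xs p ps

Lo-ub : ∀ G → All (λ x → Ro x ≤ Lo G) (Opts left G)
Lo-ub G = All.tabulate (λ x∈ → Lo-≥ G (Any.map (λ { refl → ≤-refl }) x∈))

Ro-≤ : ∀ G {c} → Any (λ x → Lo x ≤ c) (Opts right G) → Ro G ≤ c
Ro-≤ (num _) ()
Ro-≤ ⟨ _ ∣ x ∷ xs ⟩ (here p)  = ≤-trans (minLo-acc _ xs) p
Ro-≤ ⟨ _ ∣ x ∷ xs ⟩ (there p) = minLo-≤ _ xs p

Ro-glb : ∀ G {c} → IsNode G → All (λ x → c ≤ Lo x) (Opts right G) → c ≤ Ro G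
Ro-glb ⟨ _ ∣ x ∷ xs ⟩ _ (p ∷ ps) = minLo-glb _ xs p ps

Ro-lb : ∀ G → All (λ x → Ro G ≤ Lo x) (Opts right G)
Ro-lb G = All.tabulate (λ x∈ → Ro-≤ G (Any.map (λ { refl → ≤-refl }) x∈))

Lo-cong : ∀ G H → IsNode G → IsNode H →
          Match (λ x y → Ro x ≡ Ro y) (Opts left G) (Opts left H) → Lo G ≡ Lo H
Lo-cong G H nG nH (fw , bw) = ≤-antisym
  (Lo-lub G {Lo H} nG (All.map (λ {x} a → Lo-≥ H {Ro x} (Any.map ≤-reflexive a)) fw))
  (Lo-lub H {Lo G} nH (All.map (λ {x} a → Lo-≥ G {Ro x} (Any.map (≤-reflexive ∘ sym) a)) bw))

Ro-cong : ∀ G H → IsNode G → IsNode H →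
          Match (λ x y → Lo x ≡ Lo y) (Opts right G) (Opts right H) → Ro G ≡ Ro H
Ro-cong G H nG nH (fw , bw) = ≤-antisym
  (Ro-glb H {Ro G} nH (All.map (λ {x} a → Ro-≤ G {Lo x} (Any.map ≤-reflexive a)) bw))
  (Ro-glb G {Ro H} nG (All.map (λ {x} a → Ro-≤ H {Lo x} (Any.map (≤-reflexive ∘ sym) a)) fw))

infix 4 _≃_
_≃_ : Game → Game → Set
A ≃ B = (Lo A ≡ Lo B) × (Ro A ≡ Ro B)

≃-sym : ∀ {A B} → A ≃ B → B ≃ A
≃-sym (l , r) = sym l , sym r

≃-trans : ∀ {A B C} → A ≃ B → B ≃ C → A ≃ C
≃-trans (l , r) (l′ , r′) = trans l l′ , trans r r′

shape : Game → Maybe ℤ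
shape (num n)   = just n
shape ⟨ _ ∣ _ ⟩ = nothing

infix 4 _≋_
data _≋_ : Game → Game → Set where
  mk≋ : ∀ {G H} → shape G ≡ shape H → (∀ s → Match _≋_ (Opts s G) (Opts s H)) → G ≋ H

_⊕_ : Maybe ℤ → Maybe ℤ → Maybe ℤ
_⊕_ = zipWith _+ℤ_

shape-⊞ : ∀ G H → shape (G ⊞ H) ≡ shape G ⊕ shape H
shape-⊞ (num m)   (num n)   = refl
shape-⊞ (num m)   ⟨ _ ∣ _ ⟩ = refl
shape-⊞ ⟨ _ ∣ _ ⟩ (num n)   = refl
shape-⊞ ⟨ _ ∣ _ ⟩ ⟨ _ ∣ _ ⟩ = refl

⊕-comm : ∀ a b → a ⊕ b ≡ b ⊕ a
⊕-comm (just m) (just n) = cong just (+-comm m n)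
⊕-comm (just m) nothing  = refl
⊕-comm nothing  (just n) = refl
⊕-comm nothing  nothing  = refl

⊕-assoc : ∀ a b c → (a ⊕ b) ⊕ c ≡ a ⊕ (b ⊕ c)
⊕-assoc (just m) (just n) (just k) = cong just (+-assoc m n k)
⊕-assoc (just m) (just n) nothing  = refl
⊕-assoc (just m) nothing  _        = refl
⊕-assoc nothing  _        _        = refl

shape-cong : ∀ {G G′ H H′} → shape G ≡ shape G′ → shape H ≡ shape H′ →
             shape (G ⊞ H) ≡ shape (G′ ⊞ H′)
shape-cong {G} {G′} {H} {H′} p q =
  trans (shape-⊞ G H) (trans (cong₂ _⊕_ p q) (sym (shape-⊞ G′ H′)))

shape-comm : ∀ G H → shape (G ⊞ H) ≡ shape (H ⊞ G)
shape-comm G H = trans (shape-⊞ G H) (trans (⊕-comm (shape G) (shape H)) (sym (shape-⊞ H G)))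

shape-assoc : ∀ G H K → shape ((G ⊞ H) ⊞ K) ≡ shape (G ⊞ (H ⊞ K))
shape-assoc G H K = begin
  shape ((G ⊞ H) ⊞ K)                ≡⟨ trans (shape-⊞ (G ⊞ H) K) (cong (_⊕ shape K) (shape-⊞ G H)) ⟩
  (shape G ⊕ shape H) ⊕ shape K      ≡⟨ ⊕-assoc (shape G) (shape H) (shape K) ⟩
  shape G ⊕ (shape H ⊕ shape K)      ≡⟨ sym (trans (shape-⊞ G (H ⊞ K)) (cong (shape G ⊕_) (shape-⊞ H K))) ⟩
  shape (G ⊞ (H ⊞ K))                ∎
  where open ≡-Reasoning

≋-sum : ∀ {G H G′ H′} → shape (G ⊞ H) ≡ shape (G′ ⊞ H′) →
        (∀ s → Match _≋_ (map (_⊞ H) (Opts s G) ++ map (G ⊞_) (Opts s H))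
                         (map (_⊞ H′) (Opts s G′) ++ map (G′ ⊞_) (Opts s H′))) →
        G ⊞ H ≋ G′ ⊞ H′
≋-sum {G} {H} {G′} {H′} sh m =
  mk≋ sh λ s → subst₂ (Match _≋_) (sym (opts-⊞ s G H)) (sym (opts-⊞ s G′ H′)) (m s)

≋-refl : ∀ G → G ≋ G
≋-refl = game-ind (λ G → G ≋ G) λ G ih → mk≋ refl λ s → match-refl (ih s)

≋-sym : ∀ {G H} → G ≋ H → H ≋ G
≋-sym {G} = game-ind SymAt step G
  where
  SymAt : Game → Set
  SymAt G = ∀ {H} → G ≋ H → H ≋ G
  step : ∀ G → (∀ s → All SymAt (Opts s G)) → SymAt G
  step G ih (mk≋ sh m) = mk≋ (sym sh) λ s → match-sym (ih s) (m s)

≋-trans : ∀ {G H K} → G ≋ H → H ≋ K → G ≋ K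
≋-trans {G} = game-ind TransAt step G
  where
  TransAt : Game → Set
  TransAt G = ∀ {H K} → G ≋ H → H ≋ K → G ≋ K
  step : ∀ G → (∀ s → All TransAt (Opts s G)) → TransAt G
  step G ih (mk≋ sh m) (mk≋ sh′ m′) = mk≋ (trans sh sh′) λ s → match-trans (ih s) (m s) (m′ s)

≋-setoid : Setoid _ _
≋-setoid = record
  { Carrier = Game ; _≈_ = _≋_
  ; isEquivalence = record { refl = ≋-refl _ ; sym = ≋-sym ; trans = ≋-trans } }

≋-outcome : ∀ {G H} → G ≋ H → G ≃ H
≋-outcome {G} = game-ind OutAt step G
  where
  OutAt : Game → Set
  OutAt G = ∀ {H} → G ≋ H → G ≃ H
  step : ∀ G → (∀ s → All OutAt (Opts s G)) → OutAt G
  step (num m) _ {num n} (mk≋ sh _) = just-injective sh , just-injective sh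
  step (num m) _ {⟨ _ ∣ _ ⟩} (mk≋ () _)
  step ⟨ _ ∣ _ ⟩ _ {num n} (mk≋ () _)
  step G@(⟨ _ ∣ _ ⟩) ih {H@(⟨ _ ∣ _ ⟩)} (mk≋ _ m) =
      Lo-cong G H tt tt (match-mono (All.map (λ o {_} e → proj₂ (o e)) (ih left)) (m left))
    , Ro-cong G H tt tt (match-mono (All.map (λ o {_} e → proj₁ (o e)) (ih right)) (m right))

≋-cong : ∀ {G G′ H H′} → G ≋ G′ → H ≋ H′ → G ⊞ H ≋ G′ ⊞ H′
≋-cong {G} eG eH = game-ind CongAt step G eG eH
  where
  CongAt : Game → Set
  CongAt G = ∀ {G′ H H′} → G ≋ G′ → H ≋ H′ → G ⊞ H ≋ G′ ⊞ H′
  step : ∀ G → (∀ s → All CongAt (Opts s G)) → CongAt G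
  step G ihG eG eH = game-ind InnerAt stepH _ eG eH
    where
    InnerAt : Game → Set
    InnerAt H = ∀ {G′ H′} → G ≋ G′ → H ≋ H′ → G ⊞ H ≋ G′ ⊞ H′
    stepH : ∀ H → (∀ s → All InnerAt (Opts s H)) → InnerAt H
    stepH H ihH eG@(mk≋ sG mG) eH@(mk≋ sH mH) = ≋-sum (shape-cong sG sH) λ s →
      match-++ (match-image (All.map (λ ih {_} e → ih e eH) (ihG s)) (mG s))
               (match-image (All.map (λ ih {_} e → ih eG e) (ihH s)) (mH s))

≋-comm : ∀ G H → G ⊞ H ≋ H ⊞ G
≋-comm = game-ind CommAt λ G ihG → game-ind (λ H → G ⊞ H ≋ H ⊞ G) λ H ihH →
  ≋-sum (shape-comm G H) λ s →
    match-swap (match-map (_⊞ H) (H ⊞_) (All.map (λ ih → ih H) (ihG s)))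
               (match-map (G ⊞_) (_⊞ G) (ihH s))
  where
  CommAt : Game → Set
  CommAt G = ∀ H → G ⊞ H ≋ H ⊞ G

≋-assoc : ∀ G H K → (G ⊞ H) ⊞ K ≋ G ⊞ (H ⊞ K)
≋-assoc = game-ind AssocAt λ G ihG → game-ind (AssocAt₂ G) λ H ihH →
  game-ind (AssocAt₃ G H) λ K ihK → mk≋ (shape-assoc G H K) λ s →
    subst₂ (Match _≋_) (sym (opts-⊞⊞ˡ s G H K)) (sym (opts-⊞⊞ʳ s G H K))
      (match-++ (match-map (λ g → (g ⊞ H) ⊞ K) (λ g → g ⊞ (H ⊞ K)) (All.map (λ ih → ih H K) (ihG s)))
      (match-++ (match-map (λ h → (G ⊞ h) ⊞ K) (λ h → G ⊞ (h ⊞ K)) (All.map (λ ih → ih K) (ihH s)))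
                (match-map ((G ⊞ H) ⊞_) (λ k → G ⊞ (H ⊞ k)) (ihK s))))
  where
  AssocAt₃ : Game → Game → Game → Set
  AssocAt₃ G H K = (G ⊞ H) ⊞ K ≋ G ⊞ (H ⊞ K)
  AssocAt₂ : Game → Game → Set
  AssocAt₂ G H = ∀ K → AssocAt₃ G H K
  AssocAt : Game → Set
  AssocAt G = ∀ H → AssocAt₂ G H

≋-swapʳ : ∀ A B C → (A ⊞ B) ⊞ C ≋ (A ⊞ C) ⊞ B
≋-swapʳ A B C = begin
  (A ⊞ B) ⊞ C  ≈⟨ ≋-assoc A B C ⟩
  A ⊞ (B ⊞ C)  ≈⟨ ≋-cong (≋-refl A) (≋-comm B C) ⟩
  A ⊞ (C ⊞ B)  ≈⟨ ≋-sym (≋-assoc A C B) ⟩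
  (A ⊞ C) ⊞ B  ∎
  where open import Relation.Binary.Reasoning.Setoid ≋-setoid

≈-refl : ∀ {G} → G ≈ G
≈-refl _ _ = refl , refl

≈-sym : ∀ {G H} → G ≈ H → H ≈ G
≈-sym {G} {H} G≈H X w = ≃-sym {G ⊞ X} {H ⊞ X} (G≈H X w)

≈-trans : ∀ {G H K} → G ≈ H → H ≈ K → G ≈ K
≈-trans {G} {H} {K} G≈H H≈K X w = ≃-trans {G ⊞ X} {H ⊞ X} {K ⊞ X} (G≈H X w) (H≈K X w)

≋⇒≈ : ∀ {G H} → G ≋ H → G ≈ H
≋⇒≈ e X _ = ≋-outcome (≋-cong e (≋-refl X))

-- Adding a game of W preserves ≈ (since W is closed under +).
≈-congʳ : ∀ {G H K} → IsW K → G ≈ H → G ⊞ K ≈ H ⊞ K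
≈-congʳ {G} {H} {K} (t , k) G≈H X (u , x) =
  ≃-trans {G ⊞ K ⊞ X} {G ⊞ (K ⊞ X)} {H ⊞ K ⊞ X} (≋-outcome (≋-assoc G K X))
    (≃-trans {G ⊞ (K ⊞ X)} {H ⊞ (K ⊞ X)} {H ⊞ K ⊞ X} (G≈H (K ⊞ X) (t +ℙ u , WT-⊞ k x))
      (≃-sym {H ⊞ K ⊞ X} {H ⊞ (K ⊞ X)} (≋-outcome (≋-assoc H K X))))

mutual
  ⊞-identityʳ : ∀ G → G ⊞ zeroG ≡ G
  ⊞-identityʳ (num n) = cong num (+-identityʳ n)
  ⊞-identityʳ ⟨ x ∷ xs ∣ y ∷ ys ⟩ =
    cong₂ ⟨_∣_⟩ (cong₂ _∷_ (⊞-identityʳ x) (addˡ-identityʳ xs))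
                (cong₂ _∷_ (⊞-identityʳ y) (addˡ-identityʳ ys))

  addˡ-identityʳ : ∀ xs → addˡ xs zeroG ≡ xs
  addˡ-identityʳ []       = refl
  addˡ-identityʳ (x ∷ xs) = cong₂ _∷_ (⊞-identityʳ x) (addˡ-identityʳ xs)

star-odd : WT 1ℙ star
star-odd = node (num ∷ []) (num ∷ [])

Opts-star : ∀ s → Opts s star ≡ zeroG ∷ []
Opts-star left  = refl
Opts-star right = refl

-- A + 0 = A is an option of A + * on either side.
Ro[A+*]≤Lo[A] : ∀ A → Ro (A ⊞ star) ≤ Lo A
Ro[A+*]≤Lo[A] A = Ro-≤ (A ⊞ star) (subst (Any _) (sym (opts-⊞ right A star))
  (++⁺ʳ (map (_⊞ star) (Opts right A)) (here (≤-reflexive (cong Lo (⊞-identityʳ A))))))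

Ro[A]≤Lo[A+*] : ∀ A → Ro A ≤ Lo (A ⊞ star)
Ro[A]≤Lo[A+*] A = Lo-≥ (A ⊞ star) (subst (Any _) (sym (opts-⊞ left A star))
  (++⁺ʳ (map (_⊞ star) (Opts left A)) (here (≤-reflexive (sym (cong Ro (⊞-identityʳ A)))))))

opts-⊞** : ∀ s A → Opts s (A ⊞ star ⊞ star) ≡
                   map (λ x → x ⊞ star ⊞ star) (Opts s A) ++ (A ⊞ star ∷ A ⊞ star ∷ [])
opts-⊞** s A rewrite opts-⊞⊞ˡ s A star star | Opts-star s
                   | ⊞-identityʳ A | ⊞-identityʳ (A ⊞ star) = refl

Lo≤-from-** : ∀ A {c} → All (λ x → Ro (x ⊞ star ⊞ star) ≡ Ro x) (Opts left A) →
  All (λ y → Ro y ≤ c) (map (λ x → x ⊞ star ⊞ star) (Opts left A) ++ (A ⊞ star ∷ A ⊞ star ∷ [])) →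
  Lo A ≤ c
Lo≤-from-** (num n) _ (p ∷ _) = ≤-trans (≤-reflexive (sym (+-identityʳ n))) p
Lo≤-from-** A@(⟨ _ ∣ _ ⟩) ih ps = Lo-lub A tt
  (All.zipWith (λ (eq , le) → ≤-trans (≤-reflexive (sym eq)) le) (ih , All-map⁻ (++⁻ˡ _ ps)))

≤Ro-from-** : ∀ A {c} → All (λ x → Lo (x ⊞ star ⊞ star) ≡ Lo x) (Opts right A) →
  All (λ y → c ≤ Lo y) (map (λ x → x ⊞ star ⊞ star) (Opts right A) ++ (A ⊞ star ∷ A ⊞ star ∷ [])) →
  c ≤ Ro A
≤Ro-from-** (num n) _ (p ∷ _) = ≤-trans p (≤-reflexive (+-identityʳ n))
≤Ro-from-** A@(⟨ _ ∣ _ ⟩) ih ps = Ro-glb A tt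
  (All.zipWith (λ (eq , le) → ≤-trans le (≤-reflexive eq)) (ih , All-map⁻ (++⁻ˡ _ ps)))

star-star-Lo : ∀ A → All (λ x → Ro (x ⊞ star ⊞ star) ≡ Ro x) (Opts left A) →
               Lo (A ⊞ star ⊞ star) ≡ Lo A
star-star-Lo A ih = ≤-antisym upper (Lo≤-from-** A ih (subst (All _) (opts-⊞** left A) (Lo-ub S)))
  where
  S = A ⊞ star ⊞ star
  upper : Lo S ≤ Lo A
  upper = Lo-lub S (⊞-node (A ⊞ star)) (subst (All _) (sym (opts-⊞** left A))
    (++⁺ (All-map⁺ (All.zipWith (λ (eq , le) → ≤-trans (≤-reflexive eq) le) (ih , Lo-ub A)))
         (Ro[A+*]≤Lo[A] A ∷ Ro[A+*]≤Lo[A] A ∷ [])))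

star-star-Ro : ∀ A → All (λ x → Lo (x ⊞ star ⊞ star) ≡ Lo x) (Opts right A) →
               Ro (A ⊞ star ⊞ star) ≡ Ro A
star-star-Ro A ih = ≤-antisym (≤Ro-from-** A ih (subst (All _) (opts-⊞** right A) (Ro-lb S))) lower
  where
  S = A ⊞ star ⊞ star
  lower : Ro A ≤ Ro S
  lower = Ro-glb S (⊞-node (A ⊞ star)) (subst (All _) (sym (opts-⊞** right A))
    (++⁺ (All-map⁺ (All.zipWith (λ (eq , le) → ≤-trans le (≤-reflexive (sym eq))) (ih , Ro-lb A)))
         (Ro[A]≤Lo[A+*] A ∷ Ro[A]≤Lo[A+*] A ∷ [])))

star-star : ∀ A → A ⊞ star ⊞ star ≃ A
star-star = game-ind (λ A → A ⊞ star ⊞ star ≃ A) λ A ih →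
  star-star-Lo A (All.map proj₂ (ih left)) , star-star-Ro A (All.map proj₁ (ih right))

star-involutive : ∀ G → G ⊞ star ⊞ star ≈ G
star-involutive G X _ = ≃-trans {G ⊞ star ⊞ star ⊞ X} {G ⊞ X ⊞ star ⊞ star} {G ⊞ X}
  (≋-outcome shuffle) (star-star (G ⊞ X))
  where
  open import Relation.Binary.Reasoning.Setoid ≋-setoid
  shuffle : G ⊞ star ⊞ star ⊞ X ≋ G ⊞ X ⊞ star ⊞ star
  shuffle = begin
    G ⊞ star ⊞ star ⊞ X  ≈⟨ ≋-swapʳ (G ⊞ star) star X ⟩
    G ⊞ star ⊞ X ⊞ star  ≈⟨ ≋-cong (≋-swapʳ G star X) (≋-refl star) ⟩
    G ⊞ X ⊞ star ⊞ star  ∎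

star-pair : ∀ G H → (G ⊞ star) ⊞ (H ⊞ star) ≈ G ⊞ H
star-pair G H = ≈-trans {G ⊞ star ⊞ (H ⊞ star)} {G ⊞ H ⊞ star ⊞ star} {G ⊞ H}
  (≋⇒≈ collect) (star-involutive (G ⊞ H))
  where
  open import Relation.Binary.Reasoning.Setoid ≋-setoid
  collect : (G ⊞ star) ⊞ (H ⊞ star) ≋ G ⊞ H ⊞ star ⊞ star
  collect = begin
    (G ⊞ star) ⊞ (H ⊞ star)  ≈⟨ ≋-sym (≋-assoc (G ⊞ star) H star) ⟩
    G ⊞ star ⊞ H ⊞ star      ≈⟨ ≋-cong (≋-swapʳ G star H) (≋-refl star) ⟩
    G ⊞ H ⊞ star ⊞ star      ∎

data Bounded (lo hi : ℤ) : Game → Set where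
  leaf   : ∀ {n} → lo ≤ n → n ≤ hi → Bounded lo hi (num n)
  branch : ∀ {L R} → All (Bounded lo hi) (toList L) → All (Bounded lo hi) (toList R) →
           Bounded lo hi ⟨ L ∣ R ⟩

InRange : ℤ → ℤ → ℤ → Set
InRange lo hi n = (lo ≤ n) × (n ≤ hi)

mutual
  bounded-outcomes : ∀ {lo hi G} → Bounded lo hi G → InRange lo hi (Lo G) × InRange lo hi (Ro G)
  bounded-outcomes (leaf p q) = (p , q) , (p , q)
  bounded-outcomes {G = G} (branch bl@(bx ∷ _) br@(by ∷ _)) =
      (≤-trans (proj₁ (proj₂ (bounded-outcomes bx))) (Lo-≥ G (here ≤-refl)) , Lo-lub G tt (Ro-upper bl))
    , (Ro-glb G tt (Lo-lower br) , ≤-trans (Ro-≤ G (here ≤-refl)) (proj₂ (proj₁ (bounded-outcomes by))))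

  Ro-upper : ∀ {lo hi xs} → All (Bounded lo hi) xs → All (λ x → Ro x ≤ hi) xs
  Ro-upper []       = []
  Ro-upper (b ∷ bs) = proj₂ (proj₂ (bounded-outcomes b)) ∷ Ro-upper bs

  Lo-lower : ∀ {lo hi xs} → All (Bounded lo hi) xs → All (λ x → lo ≤ Lo x) xs
  Lo-lower []       = []
  Lo-lower (b ∷ bs) = proj₁ (proj₁ (bounded-outcomes b)) ∷ Lo-lower bs

mutual
  bounded-weaken : ∀ {lo hi lo′ hi′ G} → lo′ ≤ lo → hi ≤ hi′ → Bounded lo hi G → Bounded lo′ hi′ G
  bounded-weaken p q (leaf a b)     = leaf (≤-trans p a) (≤-trans b q)
  bounded-weaken p q (branch bl br) = branch (bounded-weakenAll p q bl) (bounded-weakenAll p q br)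

  bounded-weakenAll : ∀ {lo hi lo′ hi′ xs} → lo′ ≤ lo → hi ≤ hi′ →
                      All (Bounded lo hi) xs → All (Bounded lo′ hi′) xs
  bounded-weakenAll p q []       = []
  bounded-weakenAll p q (b ∷ bs) = bounded-weaken p q b ∷ bounded-weakenAll p q bs

mutual
  bounded-shift : ∀ {lo hi G} a → Bounded lo hi G → Bounded (lo +ℤ a) (hi +ℤ a) (G ⊞ num a)
  bounded-shift a (leaf p q) = leaf (+-monoˡ-≤ a p) (+-monoˡ-≤ a q)
  bounded-shift a (branch (b ∷ bs) (c ∷ cs)) =
    branch (bounded-shift a b ∷ bounded-shiftAll a bs) (bounded-shift a c ∷ bounded-shiftAll a cs)

  bounded-shiftAll : ∀ {lo hi xs} a → All (Bounded lo hi) xs →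
                     All (Bounded (lo +ℤ a) (hi +ℤ a)) (addˡ xs (num a))
  bounded-shiftAll a []       = []
  bounded-shiftAll a (b ∷ bs) = bounded-shift a b ∷ bounded-shiftAll a bs

HasBounds : Game → Set
HasBounds G = Σ ℤ λ lo → Σ ℤ λ hi → Bounded lo hi G

commonBounds : ∀ {xs} → All HasBounds xs → Σ ℤ λ lo → Σ ℤ λ hi → All (Bounded lo hi) xs
commonBounds [] = + 0 , + 0 , []
commonBounds ((lo , hi , b) ∷ bs) with commonBounds bs
... | lo′ , hi′ , bs′ =
  lo ⊓ lo′ , hi ⊔ hi′ ,
  bounded-weaken (i⊓j≤i lo lo′) (i≤i⊔j hi hi′) b ∷ bounded-weakenAll (i⊓j≤j lo lo′) (i≤j⊔i hi hi′) bs′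

mutual
  bounds : ∀ G → HasBounds G
  bounds (num n) = n , n , leaf ≤-refl ≤-refl
  bounds ⟨ x ∷ xs ∣ y ∷ ys ⟩ with commonBounds (++⁺ (bounds x ∷ boundsAll xs) (bounds y ∷ boundsAll ys))
  ... | lo , hi , bs = lo , hi , branch (++⁻ˡ (x ∷ xs) bs) (++⁻ʳ (x ∷ xs) bs)

  boundsAll : ∀ xs → All HasBounds xs
  boundsAll []       = []
  boundsAll (x ∷ xs) = bounds x ∷ boundsAll xs

-- If K is
-- even-tempered, the player who starts in K + switch does no better than
-- the bound shifted by N against him; if K is odd-tempered, he does at
-- least as well as the bound shifted by N in his favour.
module Switch (lo hi N : ℤ) where

  switch : Game
  switch = ⟨ num (- N) ∷ [] ∣ num N ∷ [] ⟩

  switch-isOdd : WT 1ℙ switch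
  switch-isOdd = node (num ∷ []) (num ∷ [])

  EvenBound OddBound : Game → Set
  EvenBound K = (Lo (K ⊞ switch) ≤ hi -ℤ N) × (lo +ℤ N ≤ Ro (K ⊞ switch))
  OddBound  K = (lo +ℤ N ≤ Lo (K ⊞ switch)) × (Ro (K ⊞ switch) ≤ hi -ℤ N)

  -- Moving in the switch yields K ∓ N; moving in K leaves an odd game plus switch.
  even-from-options : ∀ {K} → Bounded lo hi K →
    All OddBound (Opts left K) → All OddBound (Opts right K) → EvenBound K
  even-from-options {K} b oddL oddR =
      Lo-lub (K ⊞ switch) (⊞-node K) (subst (All _) (sym (opts-⊞ left K switch))
        (++⁺ (All-map⁺ (All.map proj₂ oddL))
             (proj₂ (proj₂ (bounded-outcomes (bounded-shift (- N) b))) ∷ [])))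
    , Ro-glb (K ⊞ switch) (⊞-node K) (subst (All _) (sym (opts-⊞ right K switch))
        (++⁺ (All-map⁺ (All.map proj₁ oddR))
             (proj₁ (proj₁ (bounded-outcomes (bounded-shift N b))) ∷ [])))

  -- In an odd game the first player moves in K, to an even game plus switch.
  odd-from-options : ∀ {L R} → EvenBound (head L) → EvenBound (head R) →
                     OddBound ⟨ L ∣ R ⟩
  odd-from-options {L} {R} eL eR =
      Lo-≥ (K ⊞ switch) (subst (Any _) (sym (opts-⊞ left K switch)) (here (proj₂ eL)))
    , Ro-≤ (K ⊞ switch) (subst (Any _) (sym (opts-⊞ right K switch)) (here (proj₁ eR)))
    where K = ⟨ L ∣ R ⟩

  mutual
    switch-even : ∀ {K} → WT 0ℙ K → Bounded lo hi K → EvenBound K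
    switch-even num b = even-from-options b [] []
    switch-even (node wl wr) b@(branch bl br) =
      even-from-options b (switch-oddAll wl bl) (switch-oddAll wr br)

    switch-odd : ∀ {K} → WT 1ℙ K → Bounded lo hi K → OddBound K
    switch-odd (node {L = L} {R = R} (wx ∷ _) (wy ∷ _)) (branch (bx ∷ _) (by ∷ _)) =
      odd-from-options {L} {R} (switch-even wx bx) (switch-even wy by)

    switch-oddAll : ∀ {xs} → All (WT 1ℙ) xs → All (Bounded lo hi) xs → All OddBound xs
    switch-oddAll []       []       = []
    switch-oddAll (w ∷ ws) (b ∷ bs) = switch-odd w b ∷ switch-oddAll ws bs

separated : ∀ {lo hi} → lo ≤ hi → hi -ℤ ((hi -ℤ lo) +ℤ + 1) < lo +ℤ ((hi -ℤ lo) +ℤ + 1)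
separated {lo} {hi} lo≤hi = begin-strict
  hi -ℤ ((hi -ℤ lo) +ℤ + 1)  ≡⟨ below lo hi ⟩
  lo +ℤ - + 1                <⟨ +-monoʳ-< lo -<+ ⟩
  lo +ℤ + 0                  ≤⟨ +-monoˡ-≤ (+ 0) lo≤hi ⟩
  hi +ℤ + 0                  <⟨ +-monoʳ-< hi (+<+ (s≤s z≤n)) ⟩
  hi +ℤ + 1                  ≡⟨ above lo hi ⟩
  lo +ℤ ((hi -ℤ lo) +ℤ + 1)  ∎
  where
  open ℤP.≤-Reasoning
  below : ∀ lo hi → hi -ℤ ((hi -ℤ lo) +ℤ + 1) ≡ lo +ℤ - + 1
  below = solve-∀
  above : ∀ lo hi → hi +ℤ + 1 ≡ lo +ℤ ((hi -ℤ lo) +ℤ + 1)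
  above = solve-∀

even≉odd : ∀ {G H} → WT 0ℙ G → WT 1ℙ H → ¬ (G ≈ H)
even≉odd {G} {H} wG wH G≈H with commonBounds (bounds G ∷ bounds H ∷ [])
... | lo , hi , bG ∷ bH ∷ [] = <⇒≱ (separated lo≤hi) (begin
    lo +ℤ N          ≤⟨ proj₁ (switch-odd wH bH) ⟩
    Lo (H ⊞ switch)  ≡⟨ sym (proj₁ (G≈H switch (1ℙ , switch-isOdd))) ⟩
    Lo (G ⊞ switch)  ≤⟨ proj₁ (switch-even wG bG) ⟩
    hi -ℤ N          ∎)
  where
  N = (hi -ℤ lo) +ℤ + 1
  open Switch lo hi N
  open ℤP.≤-Reasoning
  lo≤hi : lo ≤ hi
  lo≤hi = let (lo≤LoG , LoG≤hi) = proj₁ (bounded-outcomes bG) in ≤-trans lo≤LoG LoG≤hi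

toProduct : W → Z₂×W⁰
toProduct (G , 0ℙ , g) = 0ℙ , (G , g)
toProduct (G , 1ℙ , g) = 1ℙ , (G ⊞ star , WT-⊞ g star-odd)

-- toProduct is well defined on classes: tempers of equivalent games agree.
toProduct-wd : ∀ x y → x ≈W y → toProduct x ∼ toProduct y
toProduct-wd (G , 0ℙ , g) (H , 0ℙ , h) e = refl , e
toProduct-wd (G , 1ℙ , g) (H , 1ℙ , h) e = refl , ≈-congʳ {G} {H} (1ℙ , star-odd) e
toProduct-wd (G , 0ℙ , g) (H , 1ℙ , h) e = ⊥-elim (even≉odd g h e)
toProduct-wd (G , 1ℙ , g) (H , 0ℙ , h) e = ⊥-elim (even≉odd h g (≈-sym {G} {H} e))

-- toProduct is injective on classes, since G ↦ G + * is undone by adding * again.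
toProduct-inj : ∀ x y → toProduct x ∼ toProduct y → x ≈W y
toProduct-inj (G , 0ℙ , g) (H , 0ℙ , h) (_ , e) = e
toProduct-inj (G , 1ℙ , g) (H , 1ℙ , h) (_ , e) =
  ≈-trans {G} {G ⊞ star ⊞ star} {H} (≈-sym {G ⊞ star ⊞ star} {G} (star-involutive G))
    (≈-trans {G ⊞ star ⊞ star} {H ⊞ star ⊞ star} {H}
      (≈-congʳ {G ⊞ star} {H ⊞ star} (1ℙ , star-odd) e) (star-involutive H))
toProduct-inj (G , 0ℙ , g) (H , 1ℙ , h) (() , _)
toProduct-inj (G , 1ℙ , g) (H , 0ℙ , h) (() , _)

toProduct-surj : ∀ z → Σ W λ x → toProduct x ∼ z
toProduct-surj (0ℙ , (G , g)) = (G , 0ℙ , g) , refl , ≈-refl {G}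
toProduct-surj (1ℙ , (G , g)) = (G ⊞ star , 1ℙ , WT-⊞ g star-odd) , refl , star-involutive G

-- toProduct is additive: the * attached to odd summands can be moved and cancelled.
toProduct-+ : ∀ x y → toProduct (x +W y) ∼ (toProduct x · toProduct y)
toProduct-+ (G , 0ℙ , g) (H , 0ℙ , h) = refl , ≈-refl {G ⊞ H}
toProduct-+ (G , 0ℙ , g) (H , 1ℙ , h) = refl , ≋⇒≈ (≋-assoc G H star)
toProduct-+ (G , 1ℙ , g) (H , 0ℙ , h) = refl , ≋⇒≈ (≋-swapʳ G H star)
toProduct-+ (G , 1ℙ , g) (H , 1ℙ , h) = refl , ≈-sym {G ⊞ star ⊞ (H ⊞ star)} {G ⊞ H} (star-pair G H)

iso : MonoidIso
iso = toProduct , toProduct-wd , toProduct-inj , toProduct-surj , toProduct-+ , (refl , ≈-refl {zeroG})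

mainTheorem8 :
      (∀ G → IsW G → G ⊞ star ⊞ star ≈ G)
    × (∀ G H → IsW G → IsW H → G ≈ H → G ⊞ star ≈ H ⊞ star)
    × (∀ G → WT 0ℙ G → WT 1ℙ (G ⊞ star))
    × (∀ G → WT 1ℙ G → WT 0ℙ (G ⊞ star))
    × (∀ H → WT 1ℙ H → Σ Game λ G → WT 0ℙ G × (G ⊞ star ≈ H))
    × (∀ H → WT 0ℙ H → Σ Game λ G → WT 1ℙ G × (G ⊞ star ≈ H))
    × MonoidIso
mainTheorem8 =
    (λ G _ → star-involutive G)
  , (λ G H _ _ → ≈-congʳ {G} {H} (1ℙ , star-odd))
  , (λ G g → WT-⊞ g star-odd)
  , (λ G g → WT-⊞ g star-odd)
  , (λ H h → H ⊞ star , WT-⊞ h star-odd , star-involutive H)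
  , (λ H h → H ⊞ star , WT-⊞ h star-odd , star-involutive H)
  , iso
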